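{- Let $h,\ell$ be integers with $1<h<\ell-2$ and let $X\subseteq V(\boxplus_{h\times\ell})$ with $|X|\le h+1$. Every connected component of $\boxplus_{h\times\ell}-X$ with more than $\frac{(h-1)(h+2)}{2}$ vertices is good.
   Context: $\boxplus_{h\times\ell}$ is the $(h\times\ell)$-grid: vertex set $\{1,\dots,h\}\times\{1,\dots,\ell\}$, with $(i,j)$ adjacent to $(i',j')$ iff $|i-i'|+|j-j'|=1$; column $j$ is the set $\{(i,j): 1\le i\le h\}$. A connected component of $\boxplus_{h\times\ell}-X$ is good if it contains at least one full column. -}

module Defs where

open import Data.Nat using (ℕ; suc)
open import Data.Fin using (Fin; toℕ)
open import Data.Product using (_×_; _,_)
open import Data.Sum using (_⊎_)
open import Data.List using (List)
open import Data.List.Membership.Propositional using (_∉_)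
open import Relation.Binary.PropositionalEquality using (_≡_)

-- Vertices of the (h × ℓ)-grid: (row i, column j), 0-indexed.
Vertex : ℕ → ℕ → Set
Vertex h ℓ = Fin h × Fin ℓ

Diff1 : ℕ → ℕ → Set
Diff1 a b = (suc a ≡ b) ⊎ (suc b ≡ a)

Adj : ∀ {h ℓ} → Vertex h ℓ → Vertex h ℓ → Set
Adj (i , j) (i' , j') =
  (i ≡ i' × Diff1 (toℕ j) (toℕ j')) ⊎ (j ≡ j' × Diff1 (toℕ i) (toℕ i'))

-- Reach X u w : u and w lie in the same connected component of grid - X
-- (a walk from u to w whose vertices all avoid X).
data Reach {h ℓ : ℕ} (X : List (Vertex h ℓ)) : Vertex h ℓ → Vertex h ℓ → Set where
  here : ∀ {u} → u ∉ X → Reach X u u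
  step : ∀ {u v w} → Reach X u v → Adj v w → w ∉ X → Reach X u w

Good : ∀ {h ℓ} → List (Vertex h ℓ) → Vertex h ℓ → Set
Good {h} {ℓ} X v = Data.Product.∃ λ (j : Fin ℓ) → (i : Fin h) → Reach X v (i , j)

module Submission where

-- Let K be the component of v and a n, x n the numbers of its vertices and of vertices of X in column n.
-- If K contains no full column then every column meeting K also meets X (an X-free column lies in a
-- single component), a n ≤ h - 1, and a n′ ≤ a n + x n for neighbouring columns n, n′, since each
-- vertex of K in column n′ has its horizontal neighbour in column n either in K or in X.  As
-- |X| ≤ h + 1 < ℓ, some column z has x z = 0, hence a z = 0, and K lies on one side of z.  Walking
-- away from z, a column meeting K satisfies a n ≤ min (h - 1) (h - T) with T the part of X in the
-- columns beyond it, so |K| ≤ Σ_{r ≤ h} min (h - 1) (h - r) = (h - 1) (h + 2) / 2.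

open import Defs

open import Data.Nat using (ℕ; zero; suc; _+_; _*_; _∸_; _⊓_; _<_; _≤_; z≤n; s≤s; _≟_)
open import Data.Nat.Properties
open import Data.Nat.ListAction using (sum)
open import Data.Product using (∃; _×_; _,_; proj₁; proj₂)
open import Data.Sum using (inj₁; inj₂; swap)
open import Data.List using (List; []; _∷_; _++_; length; map; filter; cartesianProduct; allFin; upTo; downFrom; applyUpTo)
open import Data.List.Properties using (map-cong; filter-accept; filter-reject; filter-some; length-++; length-tabulate; length-upTo)
open import Function using (_∘_; id)
open import Data.List.Relation.Unary.All as All using (All; []; _∷_)
open import Data.List.Relation.Unary.Any using (Any; here; there; any?)
open import Data.List.Relation.Unary.All.Properties using (¬Any⇒All¬)
open import Data.List.Relation.Unary.AllPairs using ([]; _∷_)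
open import Data.List.Relation.Unary.Linked as Linked using (Linked; []; [-]; _∷_)
import Data.List.Relation.Unary.Linked.Properties as Linked
open import Data.List.Relation.Unary.Unique.Propositional using (Unique)
open import Data.List.Relation.Unary.Unique.Propositional.Properties using (filter⁺; upTo⁺; downFrom⁺; applyUpTo⁺₁)
open import Data.List.Membership.Propositional using (_∈_; _∉_; find; lose)
open import Data.List.Membership.Propositional.Properties using (∈-cartesianProduct⁺; ∈-allFin; ∈-filter⁺; ∈-filter⁻; ∈-++⁺ˡ; ∈-++⁺ʳ; ∈-upTo⁻; ∈-downFrom⁺; ∈-applyUpTo⁺)
open import Data.Empty using (⊥-elim)
open import Relation.Nullary using (¬_; Dec; yes; no; ¬?)
open import Relation.Nullary.Decidable using (_×-dec_; _⊎-dec_)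
open import Relation.Binary.Definitions using (DecidableEquality; tri<; tri≈; tri>)
open import Data.Fin using (Fin; toℕ; fromℕ<)
import Data.Fin.Properties as Fin
open import Data.Product.Properties using (≡-dec)
open import Relation.Binary.PropositionalEquality
open import Algebra.Properties.CommutativeSemigroup +-commutativeSemigroup using (interchange)
open import Data.Nat.Tactic.RingSolver using (solve-∀)

remove : ∀ {A : Set} {y : A} {ys : List A} → y ∈ ys →
  ∃ λ ys′ → length ys ≡ suc (length ys′) × (∀ {z} → z ∈ ys → z ≢ y → z ∈ ys′)
remove {ys = _ ∷ ys} (here refl) = ys , refl , λ { (here refl) z≢y → ⊥-elim (z≢y refl) ; (there z∈ys) _ → z∈ys }
remove {ys = y′ ∷ _} (there y∈ys) with remove y∈ys
... | ys′ , eq , keep = y′ ∷ ys′ , cong suc eq , λ { (here refl) _ → here refl ; (there z∈ys) z≢y → there (keep z∈ys z≢y) }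

module _ {A B : Set} (f : A → B) where

  length-≤-injection : ∀ {xs : List A} {ys : List B} → Unique xs →
    (∀ {x} → x ∈ xs → f x ∈ ys) →
    (∀ {x y} → x ∈ xs → y ∈ xs → f x ≡ f y → x ≡ y) →
    length xs ≤ length ys
  length-≤-injection {[]} _ _ _ = z≤n
  length-≤-injection {x ∷ xs} (x∉xs ∷ uxs) into inj with remove (into (here refl))
  ... | ys′ , eq , keep = subst (suc (length xs) ≤_) (sym eq) (s≤s (length-≤-injection uxs into′ inj′))
    where
    into′ : ∀ {y} → y ∈ xs → f y ∈ ys′
    into′ y∈xs = keep (into (there y∈xs)) λ fy≡fx → All.lookup x∉xs y∈xs (sym (inj (there y∈xs) (here refl) fy≡fx))
    inj′ : ∀ {y z} → y ∈ xs → z ∈ xs → f y ≡ f z → y ≡ z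
    inj′ y∈xs z∈xs = inj (there y∈xs) (there z∈xs)

  length-<-injection : ∀ {xs : List A} {ys : List B} {b} → Unique xs →
    (∀ {x} → x ∈ xs → f x ∈ ys) →
    (∀ {x y} → x ∈ xs → y ∈ xs → f x ≡ f y → x ≡ y) →
    b ∈ ys → (∀ {x} → x ∈ xs → f x ≢ b) →
    length xs < length ys
  length-<-injection {xs} uxs into inj b∈ys missed with remove b∈ys
  ... | ys′ , eq , keep = subst (suc (length xs) ≤_) (sym eq)
    (s≤s (length-≤-injection uxs (λ x∈xs → keep (into x∈xs) (missed x∈xs)) inj))

∑ : List ℕ → (ℕ → ℕ) → ℕ
∑ ns f = sum (map f ns)

syntax ∑ ns (λ n → e) = ∑[ n ∈ ns ] e

∑-+ : ∀ ns (f g : ℕ → ℕ) → ∑[ n ∈ ns ] (f n + g n) ≡ ∑[ n ∈ ns ] f n + ∑[ n ∈ ns ] g n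
∑-+ [] f g = refl
∑-+ (n ∷ ns) f g = trans (cong (f n + g n +_) (∑-+ ns f g)) (interchange (f n) (g n) _ _)

δ : ℕ → ℕ → ℕ
δ m n with m ≟ n
... | yes _ = 1
... | no _ = 0

∑-δ-∉ : ∀ {m} ns → m ∉ ns → ∑[ n ∈ ns ] δ m n ≡ 0
∑-δ-∉ [] _ = refl
∑-δ-∉ {m} (n ∷ ns) m∉ with m ≟ n
... | yes m≡n = ⊥-elim (m∉ (here m≡n))
... | no _ = ∑-δ-∉ ns (m∉ ∘ there)

∑-δ-unique : ∀ {m} {ns} → Unique ns → ∑[ n ∈ ns ] δ m n ≤ 1
∑-δ-unique {ns = []} _ = z≤n
∑-δ-unique {m} {n ∷ ns} (n∉ns ∷ uns) with m ≟ n
... | yes refl = ≤-reflexive (cong suc (∑-δ-∉ ns λ m∈ns → All.lookup n∉ns m∈ns refl))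
... | no _ = ∑-δ-unique uns

∑-δ-∈ : ∀ {m} {ns} → m ∈ ns → 1 ≤ ∑[ n ∈ ns ] δ m n
∑-δ-∈ {m} {n ∷ ns} m∈ with m ≟ n
... | yes _ = s≤s z≤n
∑-δ-∈ {m} {n ∷ ns} (here m≡n) | no m≢n = ⊥-elim (m≢n m≡n)
∑-δ-∈ {m} {n ∷ ns} (there m∈ns) | no _ = ≤-trans (∑-δ-∈ m∈ns) (m≤n+m _ _)

module ColumnCount {A : Set} (col : A → ℕ) where

  column : ℕ → List A → List A
  column n = filter (λ w → col w ≟ n)

  ∈-column⁻ : ∀ {n w} L → w ∈ column n L → w ∈ L × col w ≡ n
  ∈-column⁻ L = ∈-filter⁻ (λ w → col w ≟ _)

  ∈-column⁺ : ∀ {n w} L → w ∈ L → col w ≡ n → w ∈ column n L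
  ∈-column⁺ L = ∈-filter⁺ (λ w → col w ≟ _)

  column-witness : ∀ n L → 0 < length (column n L) → ∃ λ w → w ∈ L × col w ≡ n
  column-witness n L pos with column n L in eq
  ... | w ∷ _ = w , ∈-column⁻ L (subst (w ∈_) (sym eq) (here refl))

  column-pos : ∀ {n w} L → w ∈ L → col w ≡ n → 0 < length (column n L)
  column-pos L w∈L col≡n = filter-some (λ w → col w ≟ _) (lose w∈L col≡n)

  length-column-∷ : ∀ n w L → length (column n (w ∷ L)) ≡ δ (col w) n + length (column n L)
  length-column-∷ n w L with col w ≟ n
  ... | yes c≡n = cong length (filter-accept (λ w → col w ≟ n) c≡n)
  ... | no c≢n = cong length (filter-reject (λ w → col w ≟ n) c≢n)

  ∑-column-∷ : ∀ ns w L → ∑[ n ∈ ns ] length (column n (w ∷ L)) ≡ ∑[ n ∈ ns ] δ (col w) n + ∑[ n ∈ ns ] length (column n L)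
  ∑-column-∷ ns w L = trans (cong sum (map-cong (λ n → length-column-∷ n w L) ns)) (∑-+ ns _ _)

  ∑-column≤length : ∀ {ns} L → Unique ns → ∑[ n ∈ ns ] length (column n L) ≤ length L
  ∑-column≤length {ns} [] _ = ≤-reflexive (∑-zero ns)
    where
    ∑-zero : ∀ ns → ∑[ n ∈ ns ] length (column n []) ≡ 0
    ∑-zero [] = refl
    ∑-zero (_ ∷ ns) = ∑-zero ns
  ∑-column≤length {ns} (w ∷ L) uns rewrite ∑-column-∷ ns w L = +-mono-≤ (∑-δ-unique uns) (∑-column≤length L uns)

  length≤∑-column : ∀ {ns} L → (∀ {w} → w ∈ L → col w ∈ ns) → length L ≤ ∑[ n ∈ ns ] length (column n L)
  length≤∑-column [] _ = z≤n
  length≤∑-column {ns} (w ∷ L) cols rewrite ∑-column-∷ ns w L = +-mono-≤ (∑-δ-∈ (cols (here refl))) (length≤∑-column L (cols ∘ there))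

∑<length⇒zero : ∀ (f : ℕ → ℕ) ns → ∑[ n ∈ ns ] f n < length ns → ∃ λ n → n ∈ ns × f n ≡ 0
∑<length⇒zero f (n ∷ ns) ∑<len with f n ≟ 0
... | yes fn≡0 = n , here refl , fn≡0
... | no fn≢0 with ∑<length⇒zero f ns (≤-pred (≤-trans (s≤s (+-monoˡ-≤ _ (n≢0⇒n>0 fn≢0))) ∑<len))
...   | m , m∈ns , fm≡0 = m , there m∈ns , fm≡0

spread : ∀ {h} (P : ℕ → Set) → (∀ {m n} → m < h → n < h → Diff1 m n → P m → P n) →
  ∀ {k m} → k < h → m < h → P k → P m
spread {h} P move {k} {m} k<h m<h Pk = upward m m<h (downward k k<h Pk)
  where
  downward : ∀ k → k < h → P k → P 0
  downward zero _ P0 = P0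
  downward (suc k) 1+k<h P1+k = downward k (<⇒≤ 1+k<h) (move 1+k<h (<⇒≤ 1+k<h) (inj₂ refl) P1+k)
  upward : ∀ m → m < h → P 0 → P m
  upward zero _ P0 = P0
  upward (suc m) 1+m<h P0 = move (<⇒≤ 1+m<h) 1+m<h (inj₁ refl) (upward m (<⇒≤ 1+m<h) P0)

stair : ℕ → ℕ → ℕ
stair h zero = 0
stair h (suc r) = stair h r + (h ∸ 1) ⊓ (h ∸ r)

stair-mono : ∀ h {r r′} → r ≤ r′ → stair h r ≤ stair h r′
stair-mono h {r′ = zero} z≤n = ≤-refl
stair-mono h {r′ = suc r′} r≤ with m≤n⇒m<n∨m≡n r≤
... | inj₁ r<1+r′ = ≤-trans (stair-mono h (≤-pred r<1+r′)) (m≤m+n _ _)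
... | inj₂ refl = ≤-refl

-- The steps r + 1, …, g of stair (suc g) still to come contribute d, d - 1, …, 1, i.e. d (d + 1) / 2.
stair-invariant : ∀ g r d → r + d ≡ g → 2 * stair (suc g) (suc r) + d * suc d ≡ g * (suc g + 2)
stair-invariant g zero d refl = begin
  2 * (0 + d ⊓ suc d) + d * suc d  ≡⟨ cong (λ k → 2 * (0 + k) + d * suc d) (m≤n⇒m⊓n≡m (n≤1+n d)) ⟩
  2 * (0 + d) + d * suc d          ≡⟨ identity d ⟩
  d * (suc d + 2)                  ∎
  where
  open ≡-Reasoning
  identity : ∀ d → 2 * (0 + d) + d * suc d ≡ d * (suc d + 2)
  identity = solve-∀
stair-invariant g (suc r) d r+d≡g = begin
  2 * (S + g ⊓ (g ∸ r)) + d * suc d  ≡⟨ cong (λ k → 2 * (S + k) + d * suc d) next-step ⟩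
  2 * (S + suc d) + d * suc d        ≡⟨ identity S d ⟩
  2 * S + suc d * suc (suc d)        ≡⟨ stair-invariant g r (suc d) (trans (+-suc r d) r+d≡g) ⟩
  g * (suc g + 2)                    ∎
  where
  open ≡-Reasoning
  S : ℕ
  S = stair (suc g) (suc r)
  g∸r≡1+d : g ∸ r ≡ suc d
  g∸r≡1+d = trans (cong (_∸ r) (sym (trans (+-suc r d) r+d≡g))) (m+n∸m≡n r (suc d))
  next-step : g ⊓ (g ∸ r) ≡ suc d
  next-step = trans (cong (g ⊓_) g∸r≡1+d) (m≥n⇒m⊓n≡n (subst (suc d ≤_) r+d≡g (s≤s (m≤n+m d r))))
  identity : ∀ s d → 2 * (s + suc d) + d * suc d ≡ 2 * s + suc d * suc (suc d)
  identity = solve-∀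

stair-closed : ∀ h → 1 ≤ h → 2 * stair h (suc h) ≡ (h ∸ 1) * (h + 2)
stair-closed (suc g) _ = begin
  2 * (stair (suc g) (suc g) + g ⊓ (g ∸ g)) ≡⟨ cong (λ k → 2 * (stair (suc g) (suc g) + g ⊓ k)) (n∸n≡0 g) ⟩
  2 * (stair (suc g) (suc g) + g ⊓ 0)       ≡⟨ cong (λ k → 2 * (stair (suc g) (suc g) + k)) (⊓-zeroʳ g) ⟩
  2 * (stair (suc g) (suc g) + 0)           ≡⟨ cong (2 *_) (+-identityʳ (stair (suc g) (suc g))) ⟩
  2 * stair (suc g) (suc g)                 ≡⟨ +-identityʳ (2 * stair (suc g) (suc g)) ⟨
  2 * stair (suc g) (suc g) + 0 * 1         ≡⟨ stair-invariant g g 0 (+-identityʳ g) ⟩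
  g * (suc g + 2)                           ∎
  where open ≡-Reasoning

module StaircaseBound (h : ℕ) (a x : ℕ → ℕ) where

  Admissible : ℕ → Set
  Admissible n = 0 < a n → 1 ≤ x n × a n ≤ h ∸ 1

  Step : ℕ → ℕ → Set
  Step m n = a n ≤ a m + x m

  staircase-step : ∀ {n A T} → Admissible n → a n + (x n + T) ≤ suc h → A ≤ stair h T →
    a n + A ≤ stair h (x n + T)
  staircase-step {n} {A} {T} adm budget A≤ with a n ≟ 0
  ... | yes aₙ≡0 = begin
    a n + A          ≡⟨ cong (_+ A) aₙ≡0 ⟩
    A                ≤⟨ A≤ ⟩
    stair h T        ≤⟨ stair-mono h (m≤n+m T (x n)) ⟩
    stair h (x n + T) ∎
    where open ≤-Reasoning
  ... | no aₙ≢0 = begin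
    a n + A                           ≡⟨ +-comm (a n) A ⟩
    A + a n                           ≤⟨ +-mono-≤ A≤ (⊓-glb aₙ≤h-1 (m+n≤o⇒m≤o∸n (a n) aₙ+T≤h)) ⟩
    stair h T + (h ∸ 1) ⊓ (h ∸ T)     ≡⟨⟩
    stair h (suc T)                   ≤⟨ stair-mono h (+-monoˡ-≤ T 1≤xₙ) ⟩
    stair h (x n + T)                 ∎
    where
    open ≤-Reasoning
    1≤xₙ : 1 ≤ x n
    1≤xₙ = proj₁ (adm (n≢0⇒n>0 aₙ≢0))
    aₙ≤h-1 : a n ≤ h ∸ 1
    aₙ≤h-1 = proj₂ (adm (n≢0⇒n>0 aₙ≢0))
    aₙ+T≤h : a n + T ≤ h
    aₙ+T≤h = ≤-pred (begin
      suc (a n + T)  ≡⟨ +-suc (a n) T ⟨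
      a n + suc T    ≤⟨ +-monoʳ-≤ (a n) (+-monoˡ-≤ T 1≤xₙ) ⟩
      a n + (x n + T) ≤⟨ budget ⟩
      suc h          ∎)

  staircase-bound : ∀ {p n ns} → a n ≤ p → All Admissible (n ∷ ns) → Linked Step (n ∷ ns) →
    p + ∑[ m ∈ n ∷ ns ] x m ≤ suc h → ∑[ m ∈ n ∷ ns ] a m ≤ stair h (∑[ m ∈ n ∷ ns ] x m)
  staircase-bound aₙ≤p (adm ∷ []) [-] budget =
    staircase-step adm (≤-trans (+-monoˡ-≤ _ aₙ≤p) budget) z≤n
  staircase-bound {n = n} {ns} aₙ≤p (adm ∷ adms) (next≤ ∷ links) budget =
    staircase-step adm budget′ (staircase-bound next≤ adms links (≤-trans (≤-reflexive (+-assoc (a n) (x n) _)) budget′))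
    where
    budget′ : a n + ∑[ m ∈ n ∷ ns ] x m ≤ suc h
    budget′ = ≤-trans (+-monoˡ-≤ _ aₙ≤p) budget

module _ {h ℓ : ℕ} where

  col : Vertex h ℓ → ℕ
  col = toℕ ∘ proj₂

  col<ℓ : ∀ w → col w < ℓ
  col<ℓ (_ , j) = Fin.toℕ<n j

  _≟ᵥ_ : DecidableEquality (Vertex h ℓ)
  _≟ᵥ_ = ≡-dec Fin._≟_ Fin._≟_

  _∈ᵥ?_ : (w : Vertex h ℓ) (L : List (Vertex h ℓ)) → Dec (w ∈ L)
  _∈ᵥ?_ = _∈?_
    where open import Data.List.Membership.DecPropositional _≟ᵥ_ using (_∈?_)

  diff1? : ∀ m n → Dec (Diff1 m n)
  diff1? m n = (suc m ≟ n) ⊎-dec (suc n ≟ m)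

  adj? : (u w : Vertex h ℓ) → Dec (Adj u w)
  adj? (i , j) (i′ , j′) =
    ((i Fin.≟ i′) ×-dec diff1? (toℕ j) (toℕ j′)) ⊎-dec ((j Fin.≟ j′) ×-dec diff1? (toℕ i) (toℕ i′))

  vertices : List (Vertex h ℓ)
  vertices = cartesianProduct (allFin h) (allFin ℓ)

  ∈-vertices : ∀ w → w ∈ vertices
  ∈-vertices (i , j) = ∈-cartesianProduct⁺ (∈-allFin i) (∈-allFin j)

  Adj-sym : ∀ {u w : Vertex h ℓ} → Adj u w → Adj w u
  Adj-sym (inj₁ (refl , d)) = inj₁ (refl , swap d)
  Adj-sym (inj₂ (refl , d)) = inj₂ (refl , swap d)

  Adj⇒col≤suc : ∀ {u w : Vertex h ℓ} → Adj u w → col w ≤ suc (col u)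
  Adj⇒col≤suc (inj₁ (_ , inj₁ 1+u≡w)) = ≤-reflexive (sym 1+u≡w)
  Adj⇒col≤suc (inj₁ (_ , inj₂ 1+w≡u)) = ≤-trans (n≤1+n _) (≤-trans (≤-reflexive 1+w≡u) (n≤1+n _))
  Adj⇒col≤suc (inj₂ (refl , _)) = n≤1+n _

  module _ (X : List (Vertex h ℓ)) where

    stays-below : ∀ {z u w} → (∀ {w′} → Reach X u w′ → col w′ ≢ z) → Reach X u w → col u < z → col w < z
    stays-below avoid (here _) u<z = u<z
    stays-below avoid r@(step r′ adj _) u<z =
      ≤∧≢⇒< (≤-trans (Adj⇒col≤suc adj) (stays-below avoid r′ u<z)) (avoid r)

    stays-above : ∀ {z u w} → (∀ {w′} → Reach X u w′ → col w′ ≢ z) → Reach X u w → z < col u → z < col w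
    stays-above avoid (here _) z<u = z<u
    stays-above avoid r@(step r′ adj _) z<u =
      ≤∧≢⇒< (≤-pred (≤-trans (stays-above avoid r′ z<u) (Adj⇒col≤suc (Adj-sym adj)))) (≢-sym (avoid r))

    module _ (v : Vertex h ℓ) where

      Closed : List (Vertex h ℓ) → Set
      Closed K = ∀ {w w′} → w ∈ K → Adj w w′ → w′ ∉ X → w′ ∈ K

      record Component : Set where
        field
          members : List (Vertex h ℓ)
          unique : Unique members
          reachable : All (Reach X v) members
          source : v ∈ members
          closed : Closed members

        reach⇒∈ : ∀ {w} → Reach X v w → w ∈ members
        reach⇒∈ (here _) = source
        reach⇒∈ (step r adj w∉X) = closed (reach⇒∈ r) adj w∉X

      Exit : List (Vertex h ℓ) → Vertex h ℓ → Vertex h ℓ → Set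
      Exit K w w′ = Adj w w′ × w′ ∉ X × w′ ∉ K

      exit? : ∀ K → Dec (Any (λ w → Any (Exit K w) vertices) K)
      exit? K = any? (λ w → any? (λ w′ → adj? w w′ ×-dec ¬? (w′ ∈ᵥ? X) ×-dec ¬? (w′ ∈ᵥ? K)) vertices) K

      grow : (fuel : ℕ) (K : List (Vertex h ℓ)) → Unique K → All (Reach X v) K → v ∈ K →
        length vertices ≤ fuel + length K → Component
      grow fuel K uK rK vK room with exit? K
      ... | no noExit = record { members = K ; unique = uK ; reachable = rK ; source = vK ; closed = closed }
        where
        closed : Closed K
        closed {w} {w′} w∈K adj w′∉X with w′ ∈ᵥ? K
        ... | yes w′∈K = w′∈K
        ... | no w′∉K = ⊥-elim (noExit (lose w∈K (lose (∈-vertices w′) (adj , w′∉X , w′∉K))))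
      grow fuel K uK rK vK room | yes exit with find exit
      ... | w , w∈K , exitFrom-w with find exitFrom-w
      ...   | w′ , _ , adj , w′∉X , w′∉K = extend fuel room
        where
        uK′ : Unique (w′ ∷ K)
        uK′ = ¬Any⇒All¬ K w′∉K ∷ uK
        extend : ∀ fuel → length vertices ≤ fuel + length K → Component
        extend zero room = ⊥-elim (<-irrefl refl (≤-trans (length-≤-injection id uK′ (λ {u} _ → ∈-vertices u) (λ _ _ → id)) room))
        extend (suc fuel) room = grow fuel (w′ ∷ K) uK′ (step (All.lookup rK w∈K) adj w′∉X ∷ rK) (there vK)
          (≤-trans room (≤-reflexive (sym (+-suc fuel (length K)))))

      component : v ∉ X → Component
      component v∉X = grow (length vertices) (v ∷ []) ([] ∷ []) (here v∉X ∷ []) (here refl) (m≤m+n _ _)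

      open Component

      full-column? : (K : Component) → Dec (∃ λ j → ∀ i → (i , j) ∈ members K)
      full-column? K = Fin.any? λ j → Fin.all? λ i → (i , j) ∈ᵥ? members K

  open ColumnCount col

  column-row-injective : ∀ {n} L {u w} → u ∈ column n L → w ∈ column n L → proj₁ u ≡ proj₁ w → u ≡ w
  column-row-injective L {i , _} u∈ w∈ refl =
    cong (i ,_) (Fin.toℕ-injective (trans (proj₂ (∈-column⁻ L u∈)) (sym (proj₂ (∈-column⁻ L w∈)))))

module NoFullColumn {h ℓ : ℕ} {X : List (Vertex h ℓ)} {v : Vertex h ℓ} (K : Component X v)
  (noFull : ¬ ∃ λ j → ∀ i → (i , j) ∈ Component.members K) where

  open Component K
  open ColumnCount (col {h} {ℓ})

  inK inX : ℕ → ℕ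
  inK n = length (column n members)
  inX n = length (column n X)

  gap : ∀ j → ∃ λ i → (i , j) ∉ members
  gap j = Fin.¬∀⟶∃¬ h _ (λ i → (i , j) ∈ᵥ? members) (λ full → noFull (j , full))

  X-free-column-full : ∀ {j} → (∀ i → (i , j) ∉ X) → ∀ {i₁} → (i₁ , j) ∈ members → ∀ i → (i , j) ∈ members
  X-free-column-full {j} noX {i₁} i₁∈K i =
    spread P move (Fin.toℕ<n i₁) (Fin.toℕ<n i) (λ e → subst (λ i → (i , j) ∈ members) (Fin.toℕ-injective (sym e)) i₁∈K) refl
    where
    P : ℕ → Set
    P m = ∀ {i} → toℕ i ≡ m → (i , j) ∈ members
    move : ∀ {m n} → m < h → n < h → Diff1 m n → P m → P n
    move m<h _ d Pm {i} refl =
      closed (Pm (Fin.toℕ-fromℕ< m<h)) (inj₂ (refl , subst (λ k → Diff1 k (toℕ i)) (sym (Fin.toℕ-fromℕ< m<h)) d)) (noX i)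

  meets-X : ∀ n → 0 < inK n → 0 < inX n
  meets-X n pos with column-witness n members pos
  ... | (i₁ , j) , i₁∈K , refl with Fin.any? (λ i → (i , j) ∈ᵥ? X)
  ...   | yes (i , ij∈X) = column-pos X ij∈X refl
  ...   | no noX = ⊥-elim (proj₂ (gap j) (X-free-column-full (λ i ij∈X → noX (i , ij∈X)) i₁∈K (proj₁ (gap j))))

  not-full : ∀ n → 0 < inK n → inK n ≤ h ∸ 1
  not-full n pos with column-witness n members pos
  ... | (_ , j) , _ , refl with gap j
  ...   | i₀ , i₀∉K = m+n≤o⇒m≤o∸n (inK n) (≤-trans (≤-reflexive (+-comm (inK n) 1)) (begin
    suc (inK n)          ≤⟨ length-<-injection proj₁ (filter⁺ _ unique) (λ {w} _ → ∈-allFin (proj₁ w))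
                              (column-row-injective members) (∈-allFin i₀) misses-i₀ ⟩
    length (allFin h)    ≡⟨ length-tabulate id ⟩
    h                    ∎))
    where
    open ≤-Reasoning
    misses-i₀ : ∀ {w} → w ∈ column (toℕ j) members → proj₁ w ≢ i₀
    misses-i₀ {i , j′} w∈ refl with ∈-column⁻ members w∈
    ... | w∈K , j′≡j = i₀∉K (subst (λ j → (i , j) ∈ members) (Fin.toℕ-injective j′≡j) w∈K)

  ColumnAdj : ℕ → ℕ → Set
  ColumnAdj m n = Diff1 m n × m < ℓ × n < ℓ

  column-step : ∀ {m n} → ColumnAdj m n → inK n ≤ inK m + inX m
  column-step {m} {n} (d , m<ℓ , _) = begin
    inK n                                    ≤⟨ length-≤-injection shift (filter⁺ _ unique) into
                                                  (λ u∈ w∈ e → column-row-injective members u∈ w∈ (cong proj₁ e)) ⟩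
    length (column m members ++ column m X)  ≡⟨ length-++ (column m members) ⟩
    inK m + inX m                            ∎
    where
    open ≤-Reasoning
    j : Fin ℓ
    j = fromℕ< m<ℓ
    shift : Vertex h ℓ → Vertex h ℓ
    shift (i , _) = i , j
    into : ∀ {w} → w ∈ column n members → shift w ∈ column m members ++ column m X
    into {i , c} w∈ with ∈-column⁻ members w∈
    ... | w∈K , c≡n with (i , j) ∈ᵥ? X
    ...   | yes ij∈X = ∈-++⁺ʳ (column m members) (∈-column⁺ X ij∈X (Fin.toℕ-fromℕ< m<ℓ))
    ...   | no ij∉X = ∈-++⁺ˡ (∈-column⁺ members (closed w∈K adj ij∉X) (Fin.toℕ-fromℕ< m<ℓ))
      where
      adj : Adj (i , c) (i , j)
      adj = inj₁ (refl , subst₂ Diff1 (sym c≡n) (sym (Fin.toℕ-fromℕ< m<ℓ)) (swap d))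

  open StaircaseBound h inK inX

  admissible : ∀ n → Admissible n
  admissible n pos = meets-X n pos , not-full n pos

  avoids : ∀ {z} → inK z ≡ 0 → ∀ {w} → Reach X v w → col w ≢ z
  avoids empty r col≡z = n≮0 (subst (0 <_) empty (column-pos members (reach⇒∈ r) col≡z))

  module _ (|X|≤h+1 : length X ≤ h + 1) where

    bound-along : ∀ {z ns} → inK z ≡ 0 → Unique (z ∷ ns) → Linked ColumnAdj (z ∷ ns) →
      (∀ {w} → w ∈ members → col w ∈ z ∷ ns) → length members ≤ stair h (suc h)
    bound-along {z} {ns} empty uns links covers = begin
      length members                   ≤⟨ length≤∑-column members covers ⟩
      ∑[ n ∈ z ∷ ns ] inK n            ≤⟨ staircase-bound (≤-reflexive empty) (All.universal admissible _)
                                            (Linked.map column-step links) ∑inX≤ ⟩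
      stair h (∑[ n ∈ z ∷ ns ] inX n)  ≤⟨ stair-mono h ∑inX≤ ⟩
      stair h (suc h)                  ∎
      where
      open ≤-Reasoning
      ∑inX≤ : ∑[ n ∈ z ∷ ns ] inX n ≤ suc h
      ∑inX≤ = ≤-trans (∑-column≤length X uns) (≤-trans |X|≤h+1 (≤-reflexive (+-comm h 1)))

    empty-column : h + 2 ≤ ℓ → ∃ λ z → z < ℓ × inK z ≡ 0
    empty-column h+2≤ℓ =
      let z , z∈ , inX≡0 = ∑<length⇒zero inX (upTo (h + 2)) ∑inX<h+2
      in z , ≤-trans (∈-upTo⁻ z∈) h+2≤ℓ , n≤0⇒n≡0 (≮⇒≥ λ pos → n≮0 (subst (0 <_) inX≡0 (meets-X z pos)))
      where
      open ≤-Reasoning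
      ∑inX<h+2 : ∑[ n ∈ upTo (h + 2) ] inX n < length (upTo (h + 2))
      ∑inX<h+2 = begin-strict
        ∑[ n ∈ upTo (h + 2) ] inX n  ≤⟨ ∑-column≤length X (upTo⁺ (h + 2)) ⟩
        length X                     ≤⟨ |X|≤h+1 ⟩
        h + 1                        <⟨ +-monoʳ-< h ≤-refl ⟩
        h + 2                        ≡⟨ length-upTo (h + 2) ⟨
        length (upTo (h + 2))        ∎

    left-of : ∀ {z} → z < ℓ → inK z ≡ 0 → col v < z → length members ≤ stair h (suc h)
    left-of {z} z<ℓ empty v<z = bound-along empty (downFrom⁺ (suc z)) links covers
      where
      links : Linked ColumnAdj (downFrom (suc z))
      links = Linked.applyDownFrom⁺₁ id (suc z) λ 1+i<1+z →
        let 1+i<ℓ = ≤-<-trans (≤-pred 1+i<1+z) z<ℓ in inj₂ refl , 1+i<ℓ , <⇒≤ 1+i<ℓ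
      covers : ∀ {w} → w ∈ members → col w ∈ downFrom (suc z)
      covers w∈K = ∈-downFrom⁺ (m<n⇒m<1+n (stays-below X (avoids empty) (All.lookup reachable w∈K) v<z))

    -- The columns z, z + 1, …, ℓ - 1 are listed as applyUpTo (_+ z) (suc k) so that the head is z by computation.
    right-of : ∀ {z} → z < ℓ → inK z ≡ 0 → z < col v → length members ≤ stair h (suc h)
    right-of {z} z<ℓ empty z<v = bound-along empty unique′ links covers
      where
      k : ℕ
      k = ℓ ∸ suc z
      unique′ : Unique (applyUpTo (_+ z) (suc k))
      unique′ = applyUpTo⁺₁ (_+ z) (suc k) λ i<j _ → <⇒≢ (+-monoˡ-< z i<j)
      links : Linked ColumnAdj (applyUpTo (_+ z) (suc k))
      links = Linked.applyUpTo⁺₁ (_+ z) (suc k) λ {i} 1+i<1+k →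
        let 2+i+z≤ℓ = subst (_≤ ℓ) (+-suc (suc i) z) (m≤o∸n⇒m+n≤o (suc i) z<ℓ (≤-pred 1+i<1+k))
        in inj₁ refl , <⇒≤ 2+i+z≤ℓ , 2+i+z≤ℓ
      covers : ∀ {w} → w ∈ members → col w ∈ applyUpTo (_+ z) (suc k)
      covers {w} w∈K = subst (_∈ applyUpTo (_+ z) (suc k)) (m∸n+n≡m (<⇒≤ z<w))
        (∈-applyUpTo⁺ (_+ z) (s≤s (m+n≤o⇒m≤o∸n (col w ∸ z) (begin
          col w ∸ z + suc z    ≡⟨ +-suc (col w ∸ z) z ⟩
          suc (col w ∸ z + z)  ≡⟨ cong suc (m∸n+n≡m (<⇒≤ z<w)) ⟩
          suc (col w)          ≤⟨ col<ℓ w ⟩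
          ℓ                    ∎))))
        where
        open ≤-Reasoning
        z<w : z < col w
        z<w = stays-above X (avoids empty) (All.lookup reachable w∈K) z<v

    component-bound : h + 2 ≤ ℓ → length members ≤ stair h (suc h)
    component-bound h+2≤ℓ with empty-column h+2≤ℓ
    ... | z , z<ℓ , empty with <-cmp (col v) z
    ...   | tri< v<z _ _ = left-of z<ℓ empty v<z
    ...   | tri≈ _ v≡z _ = ⊥-elim (avoids empty (All.lookup reachable source) v≡z)
    ...   | tri> _ _ z<v = right-of z<ℓ empty z<v

lemma4p24 : (h ℓ : ℕ) → 1 < h → h + 2 < ℓ →
    (X : List (Vertex h ℓ)) → length X ≤ h + 1 →
    (v : Vertex h ℓ) → v ∉ X →
    (C : List (Vertex h ℓ)) → Unique C → All (Reach X v) C →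
    (h ∸ 1) * (h + 2) < 2 * length C →
    Good X v
lemma4p24 h ℓ 1<h h+2<ℓ X |X|≤h+1 v v∉X C uniqueC reachC big
  with K ← component X v v∉X
  with full-column? X v K
... | yes (j , full) = j , λ i → All.lookup (Component.reachable K) (full i)
... | no noFull = ⊥-elim (<⇒≱ big (begin
  2 * length C                        ≤⟨ *-monoʳ-≤ 2 |C|≤|K| ⟩
  2 * length (Component.members K)    ≤⟨ *-monoʳ-≤ 2 (NoFullColumn.component-bound K noFull |X|≤h+1 (<⇒≤ h+2<ℓ)) ⟩
  2 * stair h (suc h)                 ≡⟨ stair-closed h (<⇒≤ 1<h) ⟩
  (h ∸ 1) * (h + 2)                   ∎))
  where
  open ≤-Reasoning
  |C|≤|K| : length C ≤ length (Component.members K)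
  |C|≤|K| = length-≤-injection id uniqueC (λ c∈C → Component.reach⇒∈ K (All.lookup reachC c∈C)) (λ _ _ → id)
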